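{- Let $\varphi$ be a formula and $\Gamma$ a finite list of formulas of the language $\mathcal L$ described in the context. Then the sequent $\Gamma \Rightarrow \varphi$ is provable in the sequent calculus $\mathbf{FL}$ if and only if it is provable in the sequent calculus $\mathbf{FL}'$.
   Context: The language $\mathcal L$ has propositional variables, binary connectives $\to$, $\leftarrow$ (two implications), $\otimes$ (multiplicative conjunction), $\wedge$ (additive conjunction), $\vee$ (additive disjunction), unary connectives $\neg$, $\sim$ (two negations), and constants $\mathbf 1$ (unit of $\otimes$), $\mathbf 0$ (unit of multiplicative disjunction, which is not itself in the language), $\top$ (unit of $\wedge$) and $\bot$ (unit of $\vee$). Formulas are built from these in the usual way. A sequent has the form $\Gamma \Rightarrow C$, where $\Gamma$ is a finite (possibly empty) list of formulas and $C$ is either a single formula or empty. There are no structural rules of exchange, weakening or contraction. Below, $A,B$ are formulas, $\Gamma,\Gamma_1,\Gamma_2,\Gamma_3$ are finite lists of formulas, and $C$ is a right-hand side (at most one formula). A sequent is provable in a calculus if it has a finite derivation tree from the axioms by the rules. Calculus $\mathbf{FL}'$. Axioms: $A\Rightarrow A$; $\Rightarrow \mathbf 1$; $\mathbf 0\Rightarrow$; $\Gamma\Rightarrow\top$; $\bot,\Gamma\Rightarrow C$. Rules (upper sequents / lower sequent): ($\mathbf 1$W) $\Gamma\Rightarrow C$ / $\mathbf 1,\Gamma\Rightarrow C$; ($\mathbf 0$W) $\Gamma\Rightarrow$ / $\Gamma\Rightarrow\mathbf 0$; (Cut) $\Gamma_1\Rightarrow A$ and $\Gamma_2,A,\Gamma_3\Rightarrow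 C$ / $\Gamma_2,\Gamma_1,\Gamma_3\Rightarrow C$; ($\to$L) $\Gamma_1\Rightarrow A$ and $B,\Gamma_2\Rightarrow C$ / $\Gamma_1,A\to B,\Gamma_2\Rightarrow C$; ($\to$R) $A,\Gamma\Rightarrow B$ / $\Gamma\Rightarrow A\to B$; ($\leftarrow$L) $\Gamma_1\Rightarrow A$ and $B,\Gamma_2\Rightarrow C$ / $A\leftarrow B,\Gamma_1,\Gamma_2\Rightarrow C$; ($\leftarrow$R) $\Gamma,A\Rightarrow B$ / $\Gamma\Rightarrow A\leftarrow B$; ($\neg$L) $\Gamma\Rightarrow A$ / $\Gamma,\neg A\Rightarrow$; ($\neg$R) $A,\Gamma\Rightarrow$ / $\Gamma\Rightarrow\neg A$; ($\sim$L) $\Gamma\Rightarrow A$ / ${\sim}A,\Gamma\Rightarrow$; ($\sim$R) $\Gamma,A\Rightarrow$ / $\Gamma\Rightarrow{\sim}A$; ($\otimes$L) $A,B,\Gamma\Rightarrow C$ / $A\otimes B,\Gamma\Rightarrow C$; ($\otimes$R) $\Gamma_1\Rightarrow A$ and $\Gamma_2\Rightarrow B$ / $\Gamma_1,\Gamma_2\Rightarrow A\otimes B$; ($\wedge$L$_1$) $A,\Gamma\Rightarrow C$ / $A\wedge B,\Gamma\Rightarrow C$; ($\wedge$L$_2$) $B,\Gamma\Rightarrow C$ / $A\wedge B,\Gamma\Rightarrow C$; ($\wedge$R) $\Gamma\Rightarrow A$ and $\Gamma\Rightarrow B$ / $\Gamma\Rightarrow A\wedge B$; ($\vee$L) $A,\Gamma\Rightarrow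 C$ and $B,\Gamma\Rightarrow C$ / $A\vee B,\Gamma\Rightarrow C$; ($\vee$R$_1$) $\Gamma\Rightarrow A$ / $\Gamma\Rightarrow A\vee B$; ($\vee$R$_2$) $\Gamma\Rightarrow B$ / $\Gamma\Rightarrow A\vee B$. Calculus $\mathbf{FL}$ (Ono's Full Lambek calculus). Axioms: $A\Rightarrow A$; $\Rightarrow\mathbf 1$; $\mathbf 0\Rightarrow$; $\Gamma\Rightarrow\top$; $\Gamma_1,\bot,\Gamma_2\Rightarrow C$. Rules: ($\mathbf 1$W) $\Gamma_1,\Gamma_2\Rightarrow C$ / $\Gamma_1,\mathbf 1,\Gamma_2\Rightarrow C$; ($\mathbf 0$W) $\Gamma\Rightarrow$ / $\Gamma\Rightarrow\mathbf 0$; (Cut) as in $\mathbf{FL}'$; ($\to$L) $\Gamma_1\Rightarrow A$ and $\Gamma_2,B,\Gamma_3\Rightarrow C$ / $\Gamma_2,\Gamma_1,A\to B,\Gamma_3\Rightarrow C$; ($\to$R) $A,\Gamma\Rightarrow B$ / $\Gamma\Rightarrow A\to B$; ($\leftarrow$L) $\Gamma_1\Rightarrow A$ and $\Gamma_2,B,\Gamma_3\Rightarrow C$ / $\Gamma_2,A\leftarrow B,\Gamma_1,\Gamma_3\Rightarrow C$; ($\leftarrow$R) $\Gamma,A\Rightarrow B$ / $\Gamma\Rightarrow A\leftarrow B$; ($\neg$L) $\Gamma\Rightarrow A$ / $\Gamma,\neg A\Rightarrow$; ($\neg$R) $A,\Gamma\Rightarrow$ / $\Gamma\Rightarrow\neg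 A$; ($\sim$L) $\Gamma\Rightarrow A$ / ${\sim}A,\Gamma\Rightarrow$; ($\sim$R) $\Gamma,A\Rightarrow$ / $\Gamma\Rightarrow{\sim}A$; ($\otimes$L) $\Gamma_1,A,B,\Gamma_2\Rightarrow C$ / $\Gamma_1,A\otimes B,\Gamma_2\Rightarrow C$; ($\otimes$R) as in $\mathbf{FL}'$; ($\wedge$L$_1$) $\Gamma_1,A,\Gamma_2\Rightarrow C$ / $\Gamma_1,A\wedge B,\Gamma_2\Rightarrow C$; ($\wedge$L$_2$) $\Gamma_1,B,\Gamma_2\Rightarrow C$ / $\Gamma_1,A\wedge B,\Gamma_2\Rightarrow C$; ($\wedge$R) as in $\mathbf{FL}'$; ($\vee$L) $\Gamma_1,A,\Gamma_2\Rightarrow C$ and $\Gamma_1,B,\Gamma_2\Rightarrow C$ / $\Gamma_1,A\vee B,\Gamma_2\Rightarrow C$; ($\vee$R$_1$), ($\vee$R$_2$) as in $\mathbf{FL}'$. -}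

module Defs where

open import Data.Nat using (ℕ)
open import Data.List using (List; []; _∷_; _++_; [_])
open import Data.Maybe using (Maybe; just; nothing)

data Formula : Set where
  var  : ℕ → Formula
  _⇒ᶠ_ : Formula → Formula → Formula
  _⇐ᶠ_ : Formula → Formula → Formula
  _⊗_  : Formula → Formula → Formula
  _∧ᶠ_ : Formula → Formula → Formula
  _∨ᶠ_ : Formula → Formula → Formula
  ¬ᶠ   : Formula → Formula
  ∼ᶠ   : Formula → Formula
  𝟏 𝟎 ⊤ᶠ ⊥ᶠ : Formula

Ctx : Set
Ctx = List Formula

RHS : Set
RHS = Maybe Formula

infix 3 _⊢'_ _⊢_
data _⊢'_ : Ctx → RHS → Set where
  ax    : ∀ {A} → [ A ] ⊢' just A
  ax𝟏   : [] ⊢' just 𝟏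
  ax𝟎   : [ 𝟎 ] ⊢' nothing
  ax⊤   : ∀ {Γ} → Γ ⊢' just ⊤ᶠ
  ax⊥   : ∀ {Γ C} → ⊥ᶠ ∷ Γ ⊢' C
  𝟏W    : ∀ {Γ C} → Γ ⊢' C → 𝟏 ∷ Γ ⊢' C
  𝟎W    : ∀ {Γ} → Γ ⊢' nothing → Γ ⊢' just 𝟎
  cut   : ∀ {Γ₁ Γ₂ Γ₃ A C} → Γ₁ ⊢' just A → Γ₂ ++ A ∷ Γ₃ ⊢' C →
          Γ₂ ++ Γ₁ ++ Γ₃ ⊢' C
  ⇒L    : ∀ {Γ₁ Γ₂ A B C} → Γ₁ ⊢' just A → B ∷ Γ₂ ⊢' C →
          Γ₁ ++ (A ⇒ᶠ B) ∷ Γ₂ ⊢' C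
  ⇒R    : ∀ {Γ A B} → A ∷ Γ ⊢' just B → Γ ⊢' just (A ⇒ᶠ B)
  ⇐L    : ∀ {Γ₁ Γ₂ A B C} → Γ₁ ⊢' just A → B ∷ Γ₂ ⊢' C →
          (A ⇐ᶠ B) ∷ Γ₁ ++ Γ₂ ⊢' C
  ⇐R    : ∀ {Γ A B} → Γ ++ [ A ] ⊢' just B → Γ ⊢' just (A ⇐ᶠ B)
  ¬L    : ∀ {Γ A} → Γ ⊢' just A → Γ ++ [ ¬ᶠ A ] ⊢' nothing
  ¬R    : ∀ {Γ A} → A ∷ Γ ⊢' nothing → Γ ⊢' just (¬ᶠ A)
  ∼L    : ∀ {Γ A} → Γ ⊢' just A → ∼ᶠ A ∷ Γ ⊢' nothing
  ∼R    : ∀ {Γ A} → Γ ++ [ A ] ⊢' nothing → Γ ⊢' just (∼ᶠ A)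
  ⊗L    : ∀ {Γ A B C} → A ∷ B ∷ Γ ⊢' C → (A ⊗ B) ∷ Γ ⊢' C
  ⊗R    : ∀ {Γ₁ Γ₂ A B} → Γ₁ ⊢' just A → Γ₂ ⊢' just B → Γ₁ ++ Γ₂ ⊢' just (A ⊗ B)
  ∧L₁   : ∀ {Γ A B C} → A ∷ Γ ⊢' C → (A ∧ᶠ B) ∷ Γ ⊢' C
  ∧L₂   : ∀ {Γ A B C} → B ∷ Γ ⊢' C → (A ∧ᶠ B) ∷ Γ ⊢' C
  ∧R    : ∀ {Γ A B} → Γ ⊢' just A → Γ ⊢' just B → Γ ⊢' just (A ∧ᶠ B)
  ∨L    : ∀ {Γ A B C} → A ∷ Γ ⊢' C → B ∷ Γ ⊢' C → (A ∨ᶠ B) ∷ Γ ⊢' C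
  ∨R₁   : ∀ {Γ A B} → Γ ⊢' just A → Γ ⊢' just (A ∨ᶠ B)
  ∨R₂   : ∀ {Γ A B} → Γ ⊢' just B → Γ ⊢' just (A ∨ᶠ B)

data _⊢_ : Ctx → RHS → Set where
  ax    : ∀ {A} → [ A ] ⊢ just A
  ax𝟏   : [] ⊢ just 𝟏
  ax𝟎   : [ 𝟎 ] ⊢ nothing
  ax⊤   : ∀ {Γ} → Γ ⊢ just ⊤ᶠ
  ax⊥   : ∀ {Γ₁ Γ₂ C} → Γ₁ ++ ⊥ᶠ ∷ Γ₂ ⊢ C
  𝟏W    : ∀ {Γ₁ Γ₂ C} → Γ₁ ++ Γ₂ ⊢ C → Γ₁ ++ 𝟏 ∷ Γ₂ ⊢ C
  𝟎W    : ∀ {Γ} → Γ ⊢ nothing → Γ ⊢ just 𝟎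
  cut   : ∀ {Γ₁ Γ₂ Γ₃ A C} → Γ₁ ⊢ just A → Γ₂ ++ A ∷ Γ₃ ⊢ C →
          Γ₂ ++ Γ₁ ++ Γ₃ ⊢ C
  ⇒L    : ∀ {Γ₁ Γ₂ Γ₃ A B C} → Γ₁ ⊢ just A → Γ₂ ++ B ∷ Γ₃ ⊢ C →
          Γ₂ ++ Γ₁ ++ (A ⇒ᶠ B) ∷ Γ₃ ⊢ C
  ⇒R    : ∀ {Γ A B} → A ∷ Γ ⊢ just B → Γ ⊢ just (A ⇒ᶠ B)
  ⇐L    : ∀ {Γ₁ Γ₂ Γ₃ A B C} → Γ₁ ⊢ just A → Γ₂ ++ B ∷ Γ₃ ⊢ C →
          Γ₂ ++ (A ⇐ᶠ B) ∷ Γ₁ ++ Γ₃ ⊢ C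
  ⇐R    : ∀ {Γ A B} → Γ ++ [ A ] ⊢ just B → Γ ⊢ just (A ⇐ᶠ B)
  ¬L    : ∀ {Γ A} → Γ ⊢ just A → Γ ++ [ ¬ᶠ A ] ⊢ nothing
  ¬R    : ∀ {Γ A} → A ∷ Γ ⊢ nothing → Γ ⊢ just (¬ᶠ A)
  ∼L    : ∀ {Γ A} → Γ ⊢ just A → ∼ᶠ A ∷ Γ ⊢ nothing
  ∼R    : ∀ {Γ A} → Γ ++ [ A ] ⊢ nothing → Γ ⊢ just (∼ᶠ A)
  ⊗L    : ∀ {Γ₁ Γ₂ A B C} → Γ₁ ++ A ∷ B ∷ Γ₂ ⊢ C → Γ₁ ++ (A ⊗ B) ∷ Γ₂ ⊢ C
  ⊗R    : ∀ {Γ₁ Γ₂ A B} → Γ₁ ⊢ just A → Γ₂ ⊢ just B → Γ₁ ++ Γ₂ ⊢ just (A ⊗ B)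
  ∧L₁   : ∀ {Γ₁ Γ₂ A B C} → Γ₁ ++ A ∷ Γ₂ ⊢ C → Γ₁ ++ (A ∧ᶠ B) ∷ Γ₂ ⊢ C
  ∧L₂   : ∀ {Γ₁ Γ₂ A B C} → Γ₁ ++ B ∷ Γ₂ ⊢ C → Γ₁ ++ (A ∧ᶠ B) ∷ Γ₂ ⊢ C
  ∧R    : ∀ {Γ A B} → Γ ⊢ just A → Γ ⊢ just B → Γ ⊢ just (A ∧ᶠ B)
  ∨L    : ∀ {Γ₁ Γ₂ A B C} → Γ₁ ++ A ∷ Γ₂ ⊢ C → Γ₁ ++ B ∷ Γ₂ ⊢ C →
          Γ₁ ++ (A ∨ᶠ B) ∷ Γ₂ ⊢ C
  ∨R₁   : ∀ {Γ A B} → Γ ⊢ just A → Γ ⊢ just (A ∨ᶠ B)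
  ∨R₂   : ∀ {Γ A B} → Γ ⊢ just B → Γ ⊢ just (A ∨ᶠ B)

-- FL' restricts every left rule of FL to act at the front of the antecedent, so
-- FL'-derivations are FL-derivations.  Conversely, a prefix Γ of the antecedent
-- can be moved to the right as the iterated implication Γ ⇒* C (by ⇒R, and back
-- by cutting against A , A ⇒ B ⊢' B), and an empty right-hand side can be
-- replaced by 𝟎; hence a rule acting in the middle of the antecedent becomes a
-- rule acting at its front, and FL' simulates FL rule by rule.
module Submission where

open import Defs
open import Data.Maybe using (just; nothing)
open import Data.List using (List; []; _∷_; _++_; [_])
open import Data.List.Properties using (++-assoc; ++-identityʳ)
open import Function.Bundles using (_⇔_; mk⇔)
open import Relation.Binary.PropositionalEquality using (subst; sym)

_⇒*_ : Ctx → Formula → Formula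
[]      ⇒* D = D
(A ∷ Γ) ⇒* D = Γ ⇒* (A ⇒ᶠ D)

⇒R⁻¹ : ∀ {Γ A B} → Γ ⊢' just (A ⇒ᶠ B) → A ∷ Γ ⊢' just B
⇒R⁻¹ {Γ} {A} {B} p = subst (λ Δ → A ∷ Δ ⊢' just B) (++-identityʳ Γ)
  (cut {Γ₂ = [ A ]} {Γ₃ = []} p (⇒L {Γ₁ = [ A ]} {Γ₂ = []} ax ax))

curry* : ∀ Γ {Δ D} → Γ ++ Δ ⊢' just D → Δ ⊢' just (Γ ⇒* D)
curry* []      p = p
curry* (A ∷ Γ) p = curry* Γ (⇒R p)

uncurry* : ∀ Γ {Δ D} → Δ ⊢' just (Γ ⇒* D) → Γ ++ Δ ⊢' just D
uncurry* []      p = p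
uncurry* (A ∷ Γ) p = ⇒R⁻¹ (uncurry* Γ p)

rhs : RHS → Formula
rhs (just D) = D
rhs nothing  = 𝟎

toRhs : ∀ {Γ} C → Γ ⊢' C → Γ ⊢' just (rhs C)
toRhs (just D) p = p
toRhs nothing  p = 𝟎W p

fromRhs : ∀ {Γ} C → Γ ⊢' just (rhs C) → Γ ⊢' C
fromRhs (just D) p = p
fromRhs {Γ} nothing p = subst (λ Δ → Δ ⊢' nothing) (++-identityʳ Γ)
  (cut {Γ₂ = []} {Γ₃ = []} p ax𝟎)

replaceSuffix : ∀ Γ {Δ Δ' C} → (∀ {D} → Δ ⊢' just D → Δ' ⊢' just D) →
                Γ ++ Δ ⊢' C → Γ ++ Δ' ⊢' C
replaceSuffix Γ {C = C} f p =
  fromRhs C (uncurry* Γ (f (curry* Γ (toRhs C p))))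

⇒L-inside : ∀ Γ {Γ₁ Δ A B C} → Γ₁ ⊢' just A → Γ ++ B ∷ Δ ⊢' C →
            Γ ++ Γ₁ ++ (A ⇒ᶠ B) ∷ Δ ⊢' C
⇒L-inside Γ {Γ₁} {Δ} {A} {B} {C} p q =
  subst (λ Θ → Γ ++ Θ ⊢' C) (++-assoc Γ₁ [ A ⇒ᶠ B ] Δ)
    (replaceSuffix Γ (λ r → subst (_⊢' _) (sym (++-assoc Γ₁ [ A ⇒ᶠ B ] Δ)) (⇒L p r)) q)

∨L-inside : ∀ Γ {Δ A B C} → Γ ++ A ∷ Δ ⊢' C → Γ ++ B ∷ Δ ⊢' C →
            Γ ++ (A ∨ᶠ B) ∷ Δ ⊢' C
∨L-inside Γ {C = C} p q = fromRhs C (uncurry* Γ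
  (∨L (curry* Γ (toRhs C p)) (curry* Γ (toRhs C q))))

⊥-inside : ∀ Γ {Δ C} → Γ ++ ⊥ᶠ ∷ Δ ⊢' C
⊥-inside Γ {C = C} = fromRhs C (uncurry* Γ ax⊥)

FL⇒FL' : ∀ {Γ C} → Γ ⊢ C → Γ ⊢' C
FL⇒FL' ax  = ax
FL⇒FL' ax𝟏 = ax𝟏
FL⇒FL' ax𝟎 = ax𝟎
FL⇒FL' ax⊤ = ax⊤
FL⇒FL' (ax⊥ {Γ₁}) = ⊥-inside Γ₁
FL⇒FL' (𝟏W {Γ₁} p) = replaceSuffix Γ₁ 𝟏W (FL⇒FL' p)
FL⇒FL' (𝟎W p) = 𝟎W (FL⇒FL' p)
FL⇒FL' (cut p q) = cut (FL⇒FL' p) (FL⇒FL' q)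
FL⇒FL' (⇒L {Γ₂ = Γ₂} p q) = ⇒L-inside Γ₂ (FL⇒FL' p) (FL⇒FL' q)
FL⇒FL' (⇒R p) = ⇒R (FL⇒FL' p)
FL⇒FL' (⇐L {Γ₂ = Γ₂} p q) = replaceSuffix Γ₂ (⇐L (FL⇒FL' p)) (FL⇒FL' q)
FL⇒FL' (⇐R p) = ⇐R (FL⇒FL' p)
FL⇒FL' (¬L p) = ¬L (FL⇒FL' p)
FL⇒FL' (¬R p) = ¬R (FL⇒FL' p)
FL⇒FL' (∼L p) = ∼L (FL⇒FL' p)
FL⇒FL' (∼R p) = ∼R (FL⇒FL' p)
FL⇒FL' (⊗L {Γ₁} p) = replaceSuffix Γ₁ ⊗L (FL⇒FL' p)
FL⇒FL' (⊗R p q) = ⊗R (FL⇒FL' p) (FL⇒FL' q)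
FL⇒FL' (∧L₁ {Γ₁} p) = replaceSuffix Γ₁ ∧L₁ (FL⇒FL' p)
FL⇒FL' (∧L₂ {Γ₁} p) = replaceSuffix Γ₁ ∧L₂ (FL⇒FL' p)
FL⇒FL' (∧R p q) = ∧R (FL⇒FL' p) (FL⇒FL' q)
FL⇒FL' (∨L {Γ₁} p q) = ∨L-inside Γ₁ (FL⇒FL' p) (FL⇒FL' q)
FL⇒FL' (∨R₁ p) = ∨R₁ (FL⇒FL' p)
FL⇒FL' (∨R₂ p) = ∨R₂ (FL⇒FL' p)

FL'⇒FL : ∀ {Γ C} → Γ ⊢' C → Γ ⊢ C
FL'⇒FL ax  = ax
FL'⇒FL ax𝟏 = ax𝟏
FL'⇒FL ax𝟎 = ax𝟎
FL'⇒FL ax⊤ = ax⊤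
FL'⇒FL ax⊥ = ax⊥ {Γ₁ = []}
FL'⇒FL (𝟏W p) = 𝟏W {Γ₁ = []} (FL'⇒FL p)
FL'⇒FL (𝟎W p) = 𝟎W (FL'⇒FL p)
FL'⇒FL (cut p q) = cut (FL'⇒FL p) (FL'⇒FL q)
FL'⇒FL (⇒L p q) = ⇒L {Γ₂ = []} (FL'⇒FL p) (FL'⇒FL q)
FL'⇒FL (⇒R p) = ⇒R (FL'⇒FL p)
FL'⇒FL (⇐L p q) = ⇐L {Γ₂ = []} (FL'⇒FL p) (FL'⇒FL q)
FL'⇒FL (⇐R p) = ⇐R (FL'⇒FL p)
FL'⇒FL (¬L p) = ¬L (FL'⇒FL p)
FL'⇒FL (¬R p) = ¬R (FL'⇒FL p)
FL'⇒FL (∼L p) = ∼L (FL'⇒FL p)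
FL'⇒FL (∼R p) = ∼R (FL'⇒FL p)
FL'⇒FL (⊗L p) = ⊗L {Γ₁ = []} (FL'⇒FL p)
FL'⇒FL (⊗R p q) = ⊗R (FL'⇒FL p) (FL'⇒FL q)
FL'⇒FL (∧L₁ p) = ∧L₁ {Γ₁ = []} (FL'⇒FL p)
FL'⇒FL (∧L₂ p) = ∧L₂ {Γ₁ = []} (FL'⇒FL p)
FL'⇒FL (∧R p q) = ∧R (FL'⇒FL p) (FL'⇒FL q)
FL'⇒FL (∨L p q) = ∨L {Γ₁ = []} (FL'⇒FL p) (FL'⇒FL q)
FL'⇒FL (∨R₁ p) = ∨R₁ (FL'⇒FL p)
FL'⇒FL (∨R₂ p) = ∨R₂ (FL'⇒FL p)

mainTheorem1 : (Γ : Ctx) (φ : Formula) → (Γ ⊢ just φ) ⇔ (Γ ⊢' just φ)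
mainTheorem1 Γ φ = mk⇔ FL⇒FL' FL'⇒FL
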